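{- (i) $\mathcal{Z}_{q,1}=\left\langle\zeta_q^{\mathrm{OOZ}}(k_1,\dots,k_r)\,\middle|\,r\ge0,\ k_1\ge2,\ k_2,\dots,k_r\ge1\right\rangle_{\mathbb{Q}}$. (ii) $\mathcal{Z}_q=\left\langle\zeta_q^{\mathrm{OOZ}}(k_1,\dots,k_r)\,\middle|\,r\ge0,\ k_1\ge1,\ k_2,\dots,k_r\ge0\right\rangle_{\mathbb{Q}}$.
   Context: $q$ is a formal variable. For $r\ge 0$, integers $k_1,\dots,k_r\ge 0$ and polynomials $Q_1\in X\mathbb{Q}[X]$, $Q_2,\dots,Q_r\in\mathbb{Q}[X]$ with $\deg(Q_j)\le k_j$, set $\zeta_q(k_1,\dots,k_r;Q_1,\dots,Q_r):=\sum_{m_1>\dots>m_r>0}\prod_{j=1}^r\frac{Q_j(q^{m_j})}{(1-q^{m_j})^{k_j}}\in\mathbb{Q}[[q]]$ (empty value $1$). $\mathcal{Z}_q$ is the $\mathbb{Q}$-span of all these series; $\mathcal{Z}_{q,1}$ is the $\mathbb{Q}$-span of those with $k_1,\dots,k_r\ge1$, $Q_1\in X\mathbb{Q}[X]$ and $\deg(Q_j)\le k_j-1$ for all $j$. For $k_1\ge1$, $k_2,\dots,k_r\ge0$, the Ohno--Okuda--Zudilin value is $\zeta_q^{\mathrm{OOZ}}(k_1,\dots,k_r):=\zeta_q(k_1,\dots,k_r;X,1,\dots,1)=\sum_{m_1>\dots>m_r>0}\frac{q^{m_1}}{(1-q^{m_1})^{k_1}\cdots(1-q^{m_r})^{k_r}}$,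 with $\zeta_q^{\mathrm{OOZ}}(\emptyset)=1$. -}

module Defs where

open import Data.Nat using (ℕ; zero; suc; _≤_; _∸_)
open import Data.Nat.Divisibility using (_∣?_)
open import Data.Rational using (ℚ; 0ℚ; 1ℚ; _+_; _*_)
open import Data.List using (List; []; _∷_; length; map)
open import Data.List.Relation.Unary.All using (All)
open import Data.Product using (Σ; _×_; _,_; proj₁)
open import Data.Unit using (⊤)
open import Data.Bool using (if_then_else_)
open import Relation.Nullary.Decidable using (does)
open import Data.Nat using (_≟_)
open import Relation.Binary.PropositionalEquality using (_≡_)

-- Formal power series in q over ℚ, as coefficient sequences.

PS : Set
PS = ℕ → ℚ

_≈_ : PS → PS → Set
f ≈ g = ∀ n → f n ≡ g n

zeroPS : PS
zeroPS _ = 0ℚ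

onePS : PS
onePS zero    = 1ℚ
onePS (suc _) = 0ℚ

_⊕_ : PS → PS → PS
(f ⊕ g) n = f n + g n

scale : ℚ → PS → PS
scale c f n = c * f n

sumTo : ℕ → (ℕ → ℚ) → ℚ
sumTo zero    f = f 0
sumTo (suc n) f = sumTo n f + f (suc n)

_·_ : PS → PS → PS
(f · g) n = sumTo n (λ i → f i * g (n ∸ i))

pow : PS → ℕ → PS
pow f zero    = onePS
pow f (suc k) = f · pow f k

mono : ℕ → PS
mono e n = if does (n ≟ e) then 1ℚ else 0ℚ

-- 1/(1 - q^m) = Σ_{n ≥ 0} q^{m n}   (used only for m ≥ 1)
geom : ℕ → PS
geom m n = if does (m ∣? n) then 1ℚ else 0ℚ

-- Polynomials in ℚ[X] as coefficient lists, lowest degree first.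
-- deg Q ≤ k  is expressed as  length Q ≤ suc k.

Poly : Set
Poly = List ℚ

evalAt : Poly → ℕ → PS
evalAt []       m = zeroPS
evalAt (c ∷ cs) m = scale c onePS ⊕ (mono m · evalAt cs m)

ConstZero : Poly → Set
ConstZero []      = ⊤
ConstZero (c ∷ _) = c ≡ 0ℚ

-- q-multiple zeta values  ζ_q(k_1,…,k_r; Q_1,…,Q_r).
-- Data: the list ((k_1,Q_1), …, (k_r,Q_r)).

Data : Set
Data = List (ℕ × Poly)

factor : ℕ → Poly → ℕ → PS
factor k Q m = evalAt Q m · pow (geom m) k

-- Σ_{m = 1}^{M-1} F m
sumBelow : ℕ → (ℕ → PS) → PS
sumBelow zero          F = zeroPS
sumBelow (suc zero)    F = zeroPS
sumBelow (suc (suc M)) F = sumBelow (suc M) F ⊕ F (suc M)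

-- truncated sum over  M > m_1 > … > m_r > 0
S : Data → ℕ → PS
S []             M = onePS
S ((k , Q) ∷ ds) M = sumBelow M (λ m → factor k Q m · S ds m)

-- ζ_q(k;Q).  Since Q_1 ∈ X ℚ[X], every summand with m_1 > n has
-- q-order > n, so the coefficient of q^n is the coefficient of q^n of
-- the finite sum over n+1 > m_1 > … > m_r > 0.
ζq : Data → PS
ζq ds n = S ds (suc n) n

DegOK : ℕ × Poly → Set
DegOK (k , Q) = length Q ≤ suc k

ZqAdm : Data → Set
ZqAdm []             = ⊤
ZqAdm ((k , Q) ∷ ds) = ConstZero Q × DegOK (k , Q) × All DegOK ds

DegOK1 : ℕ × Poly → Set
DegOK1 (k , Q) = 1 ≤ k × length Q ≤ k

Zq1Adm : Data → Set
Zq1Adm []             = ⊤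
Zq1Adm ((k , Q) ∷ ds) = ConstZero Q × DegOK1 (k , Q) × All DegOK1 ds

ζOOZ : List ℕ → PS
ζOOZ []       = ζq []
ζOOZ (k ∷ ks) = ζq ((k , 0ℚ ∷ 1ℚ ∷ []) ∷ map (λ j → (j , 1ℚ ∷ [])) ks)

OOZ1Adm : List ℕ → Set
OOZ1Adm []       = ⊤
OOZ1Adm (k ∷ ks) = 2 ≤ k × All (1 ≤_) ks

OOZAdm : List ℕ → Set
OOZAdm []       = ⊤
OOZAdm (k ∷ ks) = 1 ≤ k

lincomb : {I : Set} → (I → PS) → List (ℚ × I) → PS
lincomb g []             = zeroPS
lincomb g ((c , i) ∷ l)  = scale c (g i) ⊕ lincomb g l

Span : {I : Set} → (I → PS) → PS → Set
Span {I} g f = Σ (List (ℚ × I)) (λ l → f ≈ lincomb g l)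

𝒵q : PS → Set
𝒵q = Span {Σ Data ZqAdm} (λ d → ζq (proj₁ d))

𝒵q1 : PS → Set
𝒵q1 = Span {Σ Data Zq1Adm} (λ d → ζq (proj₁ d))

OOZSpan1 : PS → Set
OOZSpan1 = Span {Σ (List ℕ) OOZ1Adm} (λ d → ζOOZ (proj₁ d))

OOZSpan : PS → Set
OOZSpan = Span {Σ (List ℕ) OOZAdm} (λ d → ζOOZ (proj₁ d))

-- With X = q^m, the identity X/(1 - X) = 1/(1 - X) - 1 rewrites Q(X)/(1 - X)^k, for
-- deg Q ≤ k, as a rational combination of 1/(1 - X)^j with k - deg Q ≤ j ≤ k, whose
-- coefficients do not depend on m; a leading factor X is carried along.  The nested
-- sum defining ζ_q is multilinear in its factors, so every admissible ζ_q(k; Q) is a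
-- combination of OOZ values, and the degree bounds keep the exponents admissible.
-- Conversely every OOZ value is itself an admissible ζ_q(k; Q).
module Submission where

open import Defs
open import Algebra.Bundles using (CommutativeMonoid)
open import Data.Bool using (if_then_else_)
open import Data.List using (List; []; _∷_; _++_; length; map)
open import Data.List.Relation.Unary.All as All using (All; []; _∷_)
open import Data.List.Relation.Unary.All.Properties using (++⁺; map⁺)
open import Data.Nat as ℕ using (ℕ; zero; suc; _∸_; z≤n; s≤s)
  renaming (_+_ to _+ℕ_; _≤_ to _≤ℕ_; _<_ to _<ℕ_)
import Data.Nat.Properties as ℕP
open import Data.Nat.Divisibility using (_∣_; _∣?_; ∣m+n∣m⇒∣n; ∣m∣n⇒∣m+n; ∣-refl; _∣0; ∣⇒≤)
open import Data.Product using (_×_; _,_; proj₁; proj₂; Σ; map₁; map₂; uncurry)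
open import Data.Rational using (ℚ; 0ℚ; 1ℚ; _+_; _*_; -_)
import Data.Rational.Properties as ℚP
open import Data.Unit using (tt)
open import Function using (_∘_)
open import Function.Bundles using (_⇔_; mk⇔)
open import Level using (0ℓ)
open import Relation.Binary.Bundles using (Setoid)
open import Relation.Binary.PropositionalEquality
  using (_≡_; _≢_; refl; sym; trans; cong; cong₂; subst; module ≡-Reasoning)
open import Relation.Nullary using (yes; no)
open import Relation.Nullary.Decidable using (dec-true; dec-false; does-⇔)
open import Algebra.Properties.CommutativeSemigroup
  (CommutativeMonoid.commutativeSemigroup ℚP.+-0-commutativeMonoid)
  using () renaming (interchange to +-interchange)

sumTo-cong : ∀ n {f g : ℕ → ℚ} → (∀ i → i ≤ℕ n → f i ≡ g i) → sumTo n f ≡ sumTo n g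
sumTo-cong zero    f≗g = f≗g 0 z≤n
sumTo-cong (suc n) f≗g =
  cong₂ _+_ (sumTo-cong n (λ i i≤n → f≗g i (ℕP.m≤n⇒m≤1+n i≤n))) (f≗g (suc n) ℕP.≤-refl)

sumTo-≡0 : ∀ n {f : ℕ → ℚ} → (∀ i → i ≤ℕ n → f i ≡ 0ℚ) → sumTo n f ≡ 0ℚ
sumTo-≡0 zero    f≡0 = f≡0 0 z≤n
sumTo-≡0 (suc n) f≡0 =
  trans (cong₂ _+_ (sumTo-≡0 n (λ i i≤n → f≡0 i (ℕP.m≤n⇒m≤1+n i≤n))) (f≡0 (suc n) ℕP.≤-refl))
        (ℚP.+-identityʳ 0ℚ)

sumTo-+ : ∀ n (f g : ℕ → ℚ) → sumTo n (λ i → f i + g i) ≡ sumTo n f + sumTo n g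
sumTo-+ zero    f g = refl
sumTo-+ (suc n) f g =
  trans (cong (_+ (f (suc n) + g (suc n))) (sumTo-+ n f g)) (+-interchange (sumTo n f) (sumTo n g) (f (suc n)) (g (suc n)))

sumTo-*ˡ : ∀ n c (f : ℕ → ℚ) → sumTo n (λ i → c * f i) ≡ c * sumTo n f
sumTo-*ˡ zero    c f = refl
sumTo-*ˡ (suc n) c f =
  trans (cong (_+ c * f (suc n)) (sumTo-*ˡ n c f)) (sym (ℚP.*-distribˡ-+ c _ _))

sumTo-head : ∀ n (f : ℕ → ℚ) → (∀ i → f (suc i) ≡ 0ℚ) → sumTo n f ≡ f 0
sumTo-head zero    f f≡0 = refl
sumTo-head (suc n) f f≡0 = trans (cong₂ _+_ (sumTo-head n f f≡0) (f≡0 n)) (ℚP.+-identityʳ (f 0))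

sumTo-suc : ∀ n (f : ℕ → ℚ) → sumTo (suc n) f ≡ f 0 + sumTo n (f ∘ suc)
sumTo-suc zero    f = refl
sumTo-suc (suc n) f =
  trans (cong (_+ f (suc (suc n))) (sumTo-suc n f)) (ℚP.+-assoc (f 0) _ (f (suc (suc n))))

sumTo-reverse : ∀ n (f : ℕ → ℚ) → sumTo n f ≡ sumTo n (λ i → f (n ∸ i))
sumTo-reverse zero    f = refl
sumTo-reverse (suc n) f = begin
  sumTo n f + f (suc n)                      ≡⟨ cong (_+ f (suc n)) (sumTo-reverse n f) ⟩
  sumTo n (λ i → f (n ∸ i)) + f (suc n)      ≡⟨ ℚP.+-comm _ (f (suc n)) ⟩
  f (suc n) + sumTo n (λ i → f (n ∸ i))      ≡⟨ sym (sumTo-suc n (λ i → f (suc n ∸ i))) ⟩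
  sumTo (suc n) (λ i → f (suc n ∸ i))        ∎
  where open ≡-Reasoning

sumTo-shift : ∀ e d (f : ℕ → ℚ) → (∀ i → i <ℕ e → f i ≡ 0ℚ) →
              sumTo (d +ℕ e) f ≡ sumTo d (λ t → f (t +ℕ e))
sumTo-shift zero    zero    f f≡0 = refl
sumTo-shift (suc e) zero    f f≡0 =
  trans (cong (_+ f (suc e)) (sumTo-≡0 e (λ i i≤e → f≡0 i (s≤s i≤e)))) (ℚP.+-identityˡ _)
sumTo-shift e       (suc d) f f≡0 = cong (_+ f (suc (d +ℕ e))) (sumTo-shift e d f f≡0)

split-at : (P : ℕ → Set) (e : ℕ) → (∀ n → n <ℕ e → P n) → (∀ d → P (d +ℕ e)) → ∀ n → P n
split-at P e below above n with n ℕ.<? e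
... | yes n<e = below n n<e
... | no  n≮e = subst P (ℕP.m∸n+n≡m (ℕP.≮⇒≥ n≮e)) (above (n ∸ e))

mono-≢* : ∀ {e i} (x : ℚ) → i ≢ e → mono e i * x ≡ 0ℚ
mono-≢* {e} {i} x i≢e rewrite dec-false (i ℕ.≟ e) i≢e = ℚP.*-zeroˡ x

mono-refl : ∀ e → mono e e ≡ 1ℚ
mono-refl e rewrite dec-true (e ℕ.≟ e) refl = refl

mono·-below : ∀ e f n → n <ℕ e → (mono e · f) n ≡ 0ℚ
mono·-below e f n n<e =
  sumTo-≡0 n (λ i i≤n → mono-≢* (f (n ∸ i)) (ℕP.<⇒≢ (ℕP.≤-<-trans i≤n n<e)))

mono·-shift : ∀ e f d → (mono e · f) (d +ℕ e) ≡ f d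
mono·-shift e f d = begin
  sumTo (d +ℕ e) (λ i → mono e i * f (d +ℕ e ∸ i))
    ≡⟨ sumTo-shift e d _ (λ i i<e → mono-≢* _ (ℕP.<⇒≢ i<e)) ⟩
  sumTo d (λ t → mono e (t +ℕ e) * f (d +ℕ e ∸ (t +ℕ e)))
    ≡⟨ sumTo-head d _ (λ t → mono-≢* _ (λ eq → ℕP.m+1+n≢m e (trans (ℕP.+-comm e (suc t)) eq))) ⟩
  mono e e * f (d +ℕ e ∸ e)
    ≡⟨ cong₂ _*_ (mono-refl e) (cong f (ℕP.m+n∸n≡m d e)) ⟩
  1ℚ * f d
    ≡⟨ ℚP.*-identityˡ (f d) ⟩
  f d ∎
  where open ≡-Reasoning

mono·-assoc : ∀ e f g → ((mono e · f) · g) ≈ (mono e · (f · g))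
mono·-assoc e f g = split-at (λ n → lhs n ≡ rhs n) e below above
  where
  lhs rhs : PS
  lhs = (mono e · f) · g
  rhs = mono e · (f · g)

  below : ∀ n → n <ℕ e → lhs n ≡ rhs n
  below n n<e = trans
    (sumTo-≡0 n (λ i i≤n → trans (cong (_* g (n ∸ i)) (mono·-below e f i (ℕP.≤-<-trans i≤n n<e)))
                                (ℚP.*-zeroˡ (g (n ∸ i)))))
    (sym (mono·-below e (f · g) n n<e))

  shift-∸ : ∀ d t → d +ℕ e ∸ (t +ℕ e) ≡ d ∸ t
  shift-∸ d t = trans (cong₂ _∸_ (ℕP.+-comm d e) (ℕP.+-comm t e)) (ℕP.[m+n]∸[m+o]≡n∸o e d t)

  above : ∀ d → lhs (d +ℕ e) ≡ rhs (d +ℕ e)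
  above d = begin
    sumTo (d +ℕ e) (λ i → (mono e · f) i * g (d +ℕ e ∸ i))
      ≡⟨ sumTo-shift e d _ (λ i i<e → trans (cong (_* _) (mono·-below e f i i<e)) (ℚP.*-zeroˡ (g (d +ℕ e ∸ i)))) ⟩
    sumTo d (λ t → (mono e · f) (t +ℕ e) * g (d +ℕ e ∸ (t +ℕ e)))
      ≡⟨ sumTo-cong d (λ t _ → cong₂ _*_ (mono·-shift e f t) (cong g (shift-∸ d t))) ⟩
    (f · g) d
      ≡⟨ sym (mono·-shift e (f · g) d) ⟩
    (mono e · (f · g)) (d +ℕ e) ∎
    where open ≡-Reasoning

geom-zero : ∀ m → geom m 0 ≡ 1ℚ
geom-zero m rewrite dec-true (m ∣? 0) (m ∣0) = refl

geom-below : ∀ m n → suc n <ℕ suc m → geom (suc m) (suc n) ≡ 0ℚ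
geom-below m n n<m rewrite dec-false (suc m ∣? suc n) (λ m∣n → ℕP.<⇒≱ n<m (∣⇒≤ m∣n)) = refl

geom-periodic : ∀ m d → geom (suc m) (d +ℕ suc m) ≡ geom (suc m) d
geom-periodic m d = cong (λ b → if b then 1ℚ else 0ℚ) (does-⇔ (mk⇔ to from) (suc m ∣? (d +ℕ suc m)) (suc m ∣? d))
  where
  to : suc m ∣ d +ℕ suc m → suc m ∣ d
  to m∣d+m = ∣m+n∣m⇒∣n (subst (suc m ∣_) (ℕP.+-comm d (suc m)) m∣d+m) ∣-refl
  from : suc m ∣ d → suc m ∣ d +ℕ suc m
  from m∣d = ∣m∣n⇒∣m+n m∣d ∣-refl

mono·geom : ∀ m → (mono (suc m) · geom (suc m)) ≈ (geom (suc m) ⊕ scale (- 1ℚ) onePS)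
mono·geom m = split-at (λ n → lhs n ≡ rhs n) (suc m) below above
  where
  lhs rhs : PS
  lhs = mono (suc m) · geom (suc m)
  rhs = geom (suc m) ⊕ scale (- 1ℚ) onePS

  below : ∀ n → n <ℕ suc m → lhs n ≡ rhs n
  below zero    n<m = trans (mono·-below (suc m) (geom (suc m)) 0 n<m)
                            (sym (cong (_+ (- 1ℚ * 1ℚ)) (geom-zero (suc m))))
  below (suc n) n<m = trans (mono·-below (suc m) (geom (suc m)) (suc n) n<m)
                            (sym (cong (_+ (- 1ℚ * 0ℚ)) (geom-below m n n<m)))

  above : ∀ d → lhs (d +ℕ suc m) ≡ rhs (d +ℕ suc m)
  above d = trans (mono·-shift (suc m) (geom (suc m)) d) (sym (begin
    geom (suc m) (d +ℕ suc m) + - 1ℚ * onePS (d +ℕ suc m)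
      ≡⟨ cong₂ (λ x y → x + - 1ℚ * onePS y) (geom-periodic m d) (ℕP.+-suc d m) ⟩
    geom (suc m) d + - 1ℚ * 0ℚ
      ≡⟨ ℚP.+-identityʳ (geom (suc m) d) ⟩
    geom (suc m) d ∎))
    where open ≡-Reasoning

PS-setoid : Setoid 0ℓ 0ℓ
PS-setoid = record
  { Carrier       = PS
  ; _≈_           = _≈_
  ; isEquivalence = record
    { refl  = λ _ → refl
    ; sym   = λ f≈g n → sym (f≈g n)
    ; trans = λ f≈g g≈h n → trans (f≈g n) (g≈h n)
    }
  }

open Setoid PS-setoid using () renaming (refl to ≈-refl; sym to ≈-sym)
open import Relation.Binary.Reasoning.Setoid PS-setoid

⊕-cong : ∀ {f f' g g'} → f ≈ f' → g ≈ g' → (f ⊕ g) ≈ (f' ⊕ g')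
⊕-cong f≈f' g≈g' n = cong₂ _+_ (f≈f' n) (g≈g' n)

scale-cong : ∀ c {f f'} → f ≈ f' → scale c f ≈ scale c f'
scale-cong c f≈f' n = cong (c *_) (f≈f' n)

·-cong : ∀ {f f' g g'} → f ≈ f' → g ≈ g' → (f · g) ≈ (f' · g')
·-cong f≈f' g≈g' n = sumTo-cong n (λ i _ → cong₂ _*_ (f≈f' i) (g≈g' (n ∸ i)))

·-congˡ : ∀ f {g g'} → g ≈ g' → (f · g) ≈ (f · g')
·-congˡ f = ·-cong {f} {f} ≈-refl

·-congʳ : ∀ g {f f'} → f ≈ f' → (f · g) ≈ (f' · g)
·-congʳ g f≈f' = ·-cong f≈f' (≈-refl {g})

·-comm : ∀ f g → (f · g) ≈ (g · f)
·-comm f g n = trans (sumTo-reverse n _) (sumTo-cong n (λ i i≤n →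
  trans (cong (λ j → f (n ∸ i) * g j) (ℕP.m∸[m∸n]≡n i≤n)) (ℚP.*-comm (f (n ∸ i)) (g i))))

·-distribʳ : ∀ h f g → ((f ⊕ g) · h) ≈ ((f · h) ⊕ (g · h))
·-distribʳ h f g n = trans (sumTo-cong n (λ i _ → ℚP.*-distribʳ-+ (h (n ∸ i)) (f i) (g i)))
                           (sumTo-+ n _ _)

·-distribˡ : ∀ h f g → (h · (f ⊕ g)) ≈ ((h · f) ⊕ (h · g))
·-distribˡ h f g = begin
  h · (f ⊕ g)        ≈⟨ ·-comm h (f ⊕ g) ⟩
  (f ⊕ g) · h        ≈⟨ ·-distribʳ h f g ⟩
  (f · h) ⊕ (g · h)  ≈⟨ ⊕-cong (·-comm f h) (·-comm g h) ⟩
  (h · f) ⊕ (h · g)  ∎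

scale-· : ∀ c f g → (scale c f · g) ≈ scale c (f · g)
scale-· c f g n = trans (sumTo-cong n (λ i _ → ℚP.*-assoc c (f i) (g (n ∸ i)))) (sumTo-*ˡ n c _)

·-scale : ∀ c f g → (f · scale c g) ≈ scale c (f · g)
·-scale c f g = begin
  f · scale c g    ≈⟨ ·-comm f (scale c g) ⟩
  scale c g · f    ≈⟨ scale-· c g f ⟩
  scale c (g · f)  ≈⟨ scale-cong c (·-comm g f) ⟩
  scale c (f · g)  ∎

·-zeroˡ : ∀ g → (zeroPS · g) ≈ zeroPS
·-zeroˡ g n = sumTo-≡0 n (λ i _ → ℚP.*-zeroˡ (g (n ∸ i)))

·-zeroʳ : ∀ f → (f · zeroPS) ≈ zeroPS
·-zeroʳ f = begin f · zeroPS ≈⟨ ·-comm f zeroPS ⟩ zeroPS · f ≈⟨ ·-zeroˡ f ⟩ zeroPS ∎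

·-identityˡ : ∀ g → (onePS · g) ≈ g
·-identityˡ g n = trans (sumTo-head n _ (λ i → ℚP.*-zeroˡ (g (n ∸ suc i)))) (ℚP.*-identityˡ (g n))

·-identityʳ : ∀ f → (f · onePS) ≈ f
·-identityʳ f = begin f · onePS ≈⟨ ·-comm f onePS ⟩ onePS · f ≈⟨ ·-identityˡ f ⟩ f ∎

mono·-leftComm : ∀ e f g → (f · (mono e · g)) ≈ (mono e · (f · g))
mono·-leftComm e f g = begin
  f · (mono e · g)  ≈⟨ ·-comm f (mono e · g) ⟩
  (mono e · g) · f  ≈⟨ mono·-assoc e g f ⟩
  mono e · (g · f)  ≈⟨ ·-congˡ (mono e) (·-comm g f) ⟩
  mono e · (f · g)  ∎

mono·-geom·-split : ∀ m E P → ((mono (suc m) · E) · (geom (suc m) · P)) ≈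
                              ((E · (geom (suc m) · P)) ⊕ scale (- 1ℚ) (E · P))
mono·-geom·-split m E P = begin
  (X · E) · (G · P)                         ≈⟨ mono·-assoc (suc m) E (G · P) ⟩
  X · (E · (G · P))                         ≈⟨ ≈-sym (mono·-leftComm (suc m) E (G · P)) ⟩
  E · (X · (G · P))                         ≈⟨ ·-congˡ E (≈-sym (mono·-assoc (suc m) G P)) ⟩
  E · ((X · G) · P)                         ≈⟨ ·-congˡ E (·-congʳ P (mono·geom m)) ⟩
  E · ((G ⊕ scale (- 1ℚ) onePS) · P)        ≈⟨ ·-congˡ E (·-distribʳ P G (scale (- 1ℚ) onePS)) ⟩
  E · ((G · P) ⊕ (scale (- 1ℚ) onePS · P))  ≈⟨ ·-congˡ E (⊕-cong (≈-refl {G · P}) minus-P) ⟩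
  E · ((G · P) ⊕ scale (- 1ℚ) P)            ≈⟨ ·-distribˡ E (G · P) (scale (- 1ℚ) P) ⟩
  (E · (G · P)) ⊕ (E · scale (- 1ℚ) P)      ≈⟨ ⊕-cong (≈-refl {E · (G · P)}) (·-scale (- 1ℚ) E P) ⟩
  (E · (G · P)) ⊕ scale (- 1ℚ) (E · P)      ∎
  where
  X : PS
  X = mono (suc m)
  G : PS
  G = geom (suc m)
  minus-P : (scale (- 1ℚ) onePS · P) ≈ scale (- 1ℚ) P
  minus-P = begin
    scale (- 1ℚ) onePS · P    ≈⟨ scale-· (- 1ℚ) onePS P ⟩
    scale (- 1ℚ) (onePS · P)  ≈⟨ scale-cong (- 1ℚ) (·-identityˡ P) ⟩
    scale (- 1ℚ) P            ∎

Comb : Set → Set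
Comb I = List (ℚ × I)

module _ {I : Set} where

  scaleC : ℚ → Comb I → Comb I
  scaleC c = map (map₁ (c *_))

  lincomb-cong : ∀ {g g' : I → PS} l → (∀ i → g i ≈ g' i) → lincomb g l ≈ lincomb g' l
  lincomb-cong []            g≈g' n = refl
  lincomb-cong ((c , i) ∷ l) g≈g' n = cong₂ _+_ (cong (c *_) (g≈g' i n)) (lincomb-cong l g≈g' n)

  lincomb-singleton : ∀ (g : I → PS) i → lincomb g ((1ℚ , i) ∷ []) ≈ g i
  lincomb-singleton g i n = trans (ℚP.+-identityʳ (1ℚ * g i n)) (ℚP.*-identityˡ (g i n))

  lincomb-++ : ∀ (g : I → PS) l l' → lincomb g (l ++ l') ≈ (lincomb g l ⊕ lincomb g l')
  lincomb-++ g []            l' n = sym (ℚP.+-identityˡ _)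
  lincomb-++ g ((c , i) ∷ l) l' n =
    trans (cong (c * g i n +_) (lincomb-++ g l l' n)) (sym (ℚP.+-assoc (c * g i n) _ _))

  lincomb-scaleC : ∀ (g : I → PS) d l → lincomb g (scaleC d l) ≈ scale d (lincomb g l)
  lincomb-scaleC g d []            n = sym (ℚP.*-zeroʳ d)
  lincomb-scaleC g d ((c , i) ∷ l) n =
    trans (cong₂ _+_ (ℚP.*-assoc d c (g i n)) (lincomb-scaleC g d l n))
          (sym (ℚP.*-distribˡ-+ d (c * g i n) _))

  lincomb-·ʳ : ∀ (F : I → PS) H l → (lincomb F l · H) ≈ lincomb (λ i → F i · H) l
  lincomb-·ʳ F H []            = ·-zeroˡ H
  lincomb-·ʳ F H ((c , i) ∷ l) = begin
    (scale c (F i) ⊕ lincomb F l) · H        ≈⟨ ·-distribʳ H (scale c (F i)) (lincomb F l) ⟩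
    (scale c (F i) · H) ⊕ (lincomb F l · H)  ≈⟨ ⊕-cong (scale-· c (F i) H) (lincomb-·ʳ F H l) ⟩
    scale c (F i · H) ⊕ lincomb (λ i → F i · H) l ∎

  lincomb-·ˡ : ∀ (F : I → PS) H l → (H · lincomb F l) ≈ lincomb (λ i → H · F i) l
  lincomb-·ˡ F H l = begin
    H · lincomb F l            ≈⟨ ·-comm H (lincomb F l) ⟩
    lincomb F l · H            ≈⟨ lincomb-·ʳ F H l ⟩
    lincomb (λ i → F i · H) l  ≈⟨ lincomb-cong l (λ i → ·-comm (F i) H) ⟩
    lincomb (λ i → H · F i) l  ∎

  lincomb-diagonal : ∀ (F : I → ℕ → PS) l n →
    lincomb (λ i → F i (suc n)) l n ≡ lincomb (λ i m → F i (suc m) m) l n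
  lincomb-diagonal F []            n = refl
  lincomb-diagonal F ((c , i) ∷ l) n = cong (c * F i (suc n) n +_) (lincomb-diagonal F l n)

module _ {I J : Set} where

  mapC : (I → J) → Comb I → Comb J
  mapC f = map (map₂ f)

  bindC : Comb I → (I → Comb J) → Comb J
  bindC []            L = []
  bindC ((c , i) ∷ l) L = scaleC c (L i) ++ bindC l L

  lincomb-mapC : ∀ (g : J → PS) f l → lincomb g (mapC f l) ≈ lincomb (g ∘ f) l
  lincomb-mapC g f []            n = refl
  lincomb-mapC g f ((c , i) ∷ l) n = cong (c * g (f i) n +_) (lincomb-mapC g f l n)

  lincomb-bindC : ∀ {g : I → PS} (h : J → PS) L → (∀ i → g i ≈ lincomb h (L i)) →
                  ∀ l → lincomb g l ≈ lincomb h (bindC l L)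
  lincomb-bindC         h L g≈ []            = λ _ → refl
  lincomb-bindC {g = g} h L g≈ ((c , i) ∷ l) = begin
    scale c (g i) ⊕ lincomb g l
      ≈⟨ ⊕-cong (scale-cong c (g≈ i)) (lincomb-bindC h L g≈ l) ⟩
    scale c (lincomb h (L i)) ⊕ lincomb h (bindC l L)
      ≈⟨ ⊕-cong (≈-sym (lincomb-scaleC h c (L i))) (≈-refl {lincomb h (bindC l L)}) ⟩
    lincomb h (scaleC c (L i)) ⊕ lincomb h (bindC l L)
      ≈⟨ ≈-sym (lincomb-++ h (scaleC c (L i)) (bindC l L)) ⟩
    lincomb h (scaleC c (L i) ++ bindC l L) ∎

module _ {I J : Set} where

  _⊗_ : Comb I → Comb J → Comb (I × J)
  E ⊗ L = bindC E (λ a → mapC (a ,_) L)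

  lincomb-⊗ : ∀ (F : I → PS) (G : J → PS) E L →
              (lincomb F E · lincomb G L) ≈ lincomb (λ p → F (proj₁ p) · G (proj₂ p)) (E ⊗ L)
  lincomb-⊗ F G E L = begin
    lincomb F E · lincomb G L                  ≈⟨ lincomb-·ʳ F (lincomb G L) E ⟩
    lincomb (λ a → F a · lincomb G L) E        ≈⟨ lincomb-bindC FG _ row E ⟩
    lincomb FG (E ⊗ L)                         ∎
    where
    FG : I × J → PS
    FG p = F (proj₁ p) · G (proj₂ p)
    row : ∀ a → (F a · lincomb G L) ≈ lincomb FG (mapC (a ,_) L)
    row a = begin
      F a · lincomb G L              ≈⟨ lincomb-·ˡ G (F a) L ⟩
      lincomb (λ b → F a · G b) L    ≈⟨ ≈-sym (lincomb-mapC FG (a ,_) L) ⟩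
      lincomb FG (mapC (a ,_) L)     ∎

_∷ᶜ_ : {A : Set} → Comb A → Comb (List A) → Comb (List A)
E ∷ᶜ L = mapC (uncurry _∷_) (E ⊗ L)

Supported : {I : Set} → (I → Set) → Comb I → Set
Supported P = All (P ∘ proj₂)

⊗-supported : {I J : Set} {P : I → Set} {R : J → Set} {E : Comb I} {L : Comb J} →
  Supported P E → Supported R L → Supported (λ p → P (proj₁ p) × R (proj₂ p)) (E ⊗ L)
⊗-supported []       sL = []
⊗-supported (p ∷ sE) sL = ++⁺ (map⁺ (map⁺ (All.map (p ,_) sL))) (⊗-supported sE sL)

∷ᶜ-supported : {A : Set} {P : A → Set} {R T : List A → Set} {E : Comb A} {L : Comb (List A)} →
  Supported P E → Supported R L → (∀ {a as} → P a → R as → T (a ∷ as)) → Supported T (E ∷ᶜ L)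
∷ᶜ-supported sE sL cons = map⁺ (All.map (uncurry cons) (⊗-supported sE sL))

span-generator : ∀ {I : Set} (g : I → PS) i → Span g (g i)
span-generator g i = (1ℚ , i) ∷ [] , ≈-sym (lincomb-singleton g i)

span-trans : ∀ {I J : Set} {g : I → PS} {h : J → PS} → (∀ i → Span h (g i)) → ∀ f → Span g f → Span h f
span-trans {h = h} h-span f (l , f≈) =
  bindC l (proj₁ ∘ h-span) , λ n → trans (f≈ n) (lincomb-bindC h _ (proj₂ ∘ h-span) l n)

supported-span : ∀ {A : Set} {P : A → Set} (g : A → PS) {f} l → Supported P l → f ≈ lincomb g l →
                 Span {Σ A P} (g ∘ proj₁) f
supported-span {A} {P} g l sl f≈ = attach l sl , λ n → trans (f≈ n) (sym (lincomb-attach l sl n))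
  where
  attach : (l : Comb A) → Supported P l → Comb (Σ A P)
  attach []            []       = []
  attach ((c , a) ∷ l) (p ∷ sl) = (c , (a , p)) ∷ attach l sl

  lincomb-attach : ∀ l (sl : Supported P l) → lincomb (g ∘ proj₁) (attach l sl) ≈ lincomb g l
  lincomb-attach []            []       n = refl
  lincomb-attach ((c , a) ∷ l) (p ∷ sl) n = cong (c * g a n +_) (lincomb-attach l sl n)

sumBelow-cong : ∀ {F F' : ℕ → PS} → (∀ m → F (suc m) ≈ F' (suc m)) → ∀ M → sumBelow M F ≈ sumBelow M F'
sumBelow-cong F≈ zero          n = refl
sumBelow-cong F≈ (suc zero)    n = refl
sumBelow-cong F≈ (suc (suc M)) n = cong₂ _+_ (sumBelow-cong F≈ (suc M) n) (F≈ M n)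

sumBelow-zero : ∀ M → sumBelow M (λ _ → zeroPS) ≈ zeroPS
sumBelow-zero zero          n = refl
sumBelow-zero (suc zero)    n = refl
sumBelow-zero (suc (suc M)) n = trans (ℚP.+-identityʳ _) (sumBelow-zero (suc M) n)

sumBelow-⊕ : ∀ (F G : ℕ → PS) M → sumBelow M (λ m → F m ⊕ G m) ≈ (sumBelow M F ⊕ sumBelow M G)
sumBelow-⊕ F G zero          n = sym (ℚP.+-identityʳ 0ℚ)
sumBelow-⊕ F G (suc zero)    n = sym (ℚP.+-identityʳ 0ℚ)
sumBelow-⊕ F G (suc (suc M)) n =
  trans (cong (_+ (F (suc M) n + G (suc M) n)) (sumBelow-⊕ F G (suc M) n))
        (+-interchange (sumBelow (suc M) F n) (sumBelow (suc M) G n) (F (suc M) n) (G (suc M) n))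

sumBelow-scale : ∀ c (F : ℕ → PS) M → sumBelow M (λ m → scale c (F m)) ≈ scale c (sumBelow M F)
sumBelow-scale c F zero          n = sym (ℚP.*-zeroʳ c)
sumBelow-scale c F (suc zero)    n = sym (ℚP.*-zeroʳ c)
sumBelow-scale c F (suc (suc M)) n =
  trans (cong (_+ c * F (suc M) n) (sumBelow-scale c F (suc M) n)) (sym (ℚP.*-distribˡ-+ c _ _))

sumBelow-lincomb : ∀ {I : Set} (H : I → ℕ → PS) M l →
  sumBelow M (λ m → lincomb (λ i → H i m) l) ≈ lincomb (λ i → sumBelow M (H i)) l
sumBelow-lincomb H M []            = sumBelow-zero M
sumBelow-lincomb H M ((c , i) ∷ l) = begin
  sumBelow M (λ m → scale c (H i m) ⊕ lincomb (λ i → H i m) l)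
    ≈⟨ sumBelow-⊕ (λ m → scale c (H i m)) _ M ⟩
  sumBelow M (λ m → scale c (H i m)) ⊕ sumBelow M (λ m → lincomb (λ i → H i m) l)
    ≈⟨ ⊕-cong (sumBelow-scale c (H i) M) (sumBelow-lincomb H M l) ⟩
  scale c (sumBelow M (H i)) ⊕ lincomb (λ i → sumBelow M (H i)) l ∎

S-cons-linear : ∀ {I J : Set} k Q ds (h : I → ℕ × Poly) (d : J → Data) E L →
  (∀ m → factor k Q (suc m) ≈ lincomb (λ i → uncurry factor (h i) (suc m)) E) →
  (∀ M → S ds M ≈ lincomb (λ j → S (d j) M) L) →
  ∀ M → S ((k , Q) ∷ ds) M ≈ lincomb (λ p → S (h (proj₁ p) ∷ d (proj₂ p)) M) (E ⊗ L)
S-cons-linear k Q ds h d E L factor≈ S≈ M = begin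
  sumBelow M (λ m → factor k Q m · S ds m)
    ≈⟨ sumBelow-cong (λ m → ·-cong (factor≈ m) (S≈ (suc m))) M ⟩
  sumBelow M (λ m → lincomb (λ i → uncurry factor (h i) m) E · lincomb (λ j → S (d j) m) L)
    ≈⟨ sumBelow-cong (λ m → lincomb-⊗ _ _ E L) M ⟩
  sumBelow M (λ m → lincomb (λ p → uncurry factor (h (proj₁ p)) m · S (d (proj₂ p)) m) (E ⊗ L))
    ≈⟨ sumBelow-lincomb _ M (E ⊗ L) ⟩
  lincomb (λ p → S (h (proj₁ p) ∷ d (proj₂ p)) M) (E ⊗ L) ∎

-- Q(X)/(1 - X)^k in the basis 1/(1 - X)^j: for Q = c + X R, the part X R(X)/(1 - X)^k
-- is expandX k R, computed from X/(1 - X) = 1/(1 - X) - 1.  The clause expandX zero is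
-- only reached with R = 0 under the degree bound.
mutual
  expand : ℕ → Poly → Comb ℕ
  expand k []       = []
  expand k (c ∷ cs) = (c , k) ∷ expandX k cs

  expandX : ℕ → Poly → Comb ℕ
  expandX zero    cs = []
  expandX (suc k) cs = expand (suc k) cs ++ scaleC (- 1ℚ) (expand k cs)

mutual
  factor-expand : ∀ m k Q → length Q ≤ℕ suc k →
                  factor k Q (suc m) ≈ lincomb (pow (geom (suc m))) (expand k Q)
  factor-expand m k []       _           = ·-zeroˡ (pow (geom (suc m)) k)
  factor-expand m k (c ∷ cs) (s≤s |cs|≤k) = begin
    (scale c onePS ⊕ (X · evalAt cs (suc m))) · Gᵏ
      ≈⟨ ·-distribʳ Gᵏ (scale c onePS) (X · evalAt cs (suc m)) ⟩
    (scale c onePS · Gᵏ) ⊕ ((X · evalAt cs (suc m)) · Gᵏ)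
      ≈⟨ ⊕-cong (scale-· c onePS Gᵏ) (mono·factor-expandX m k cs |cs|≤k) ⟩
    scale c (onePS · Gᵏ) ⊕ lincomb (pow (geom (suc m))) (expandX k cs)
      ≈⟨ ⊕-cong (scale-cong c (·-identityˡ Gᵏ)) (≈-refl {lincomb (pow (geom (suc m))) (expandX k cs)}) ⟩
    scale c Gᵏ ⊕ lincomb (pow (geom (suc m))) (expandX k cs) ∎
    where
    X : PS
    X = mono (suc m)
    Gᵏ : PS
    Gᵏ = pow (geom (suc m)) k

  mono·factor-expandX : ∀ m k cs → length cs ≤ℕ k →
    ((mono (suc m) · evalAt cs (suc m)) · pow (geom (suc m)) k) ≈ lincomb (pow (geom (suc m))) (expandX k cs)
  mono·factor-expandX m zero [] _ = begin
    (mono (suc m) · zeroPS) · onePS  ≈⟨ ·-congʳ onePS (·-zeroʳ (mono (suc m))) ⟩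
    zeroPS · onePS                   ≈⟨ ·-zeroˡ onePS ⟩
    zeroPS                           ∎
  mono·factor-expandX m (suc k) cs |cs|≤1+k = begin
    (mono (suc m) · E) · (geom (suc m) · Gᵏ)
      ≈⟨ mono·-geom·-split m E Gᵏ ⟩
    (E · (geom (suc m) · Gᵏ)) ⊕ scale (- 1ℚ) (E · Gᵏ)
      ≈⟨ ⊕-cong (factor-expand m (suc k) cs (ℕP.m≤n⇒m≤1+n |cs|≤1+k))
                (scale-cong (- 1ℚ) (factor-expand m k cs |cs|≤1+k)) ⟩
    lincomb Gʲ (expand (suc k) cs) ⊕ scale (- 1ℚ) (lincomb Gʲ (expand k cs))
      ≈⟨ ⊕-cong (≈-refl {lincomb Gʲ (expand (suc k) cs)}) (≈-sym (lincomb-scaleC Gʲ (- 1ℚ) (expand k cs))) ⟩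
    lincomb Gʲ (expand (suc k) cs) ⊕ lincomb Gʲ (scaleC (- 1ℚ) (expand k cs))
      ≈⟨ ≈-sym (lincomb-++ Gʲ (expand (suc k) cs) (scaleC (- 1ℚ) (expand k cs))) ⟩
    lincomb Gʲ (expandX (suc k) cs) ∎
    where
    E : PS
    E = evalAt cs (suc m)
    Gᵏ : PS
    Gᵏ = pow (geom (suc m)) k
    Gʲ : ℕ → PS
    Gʲ = pow (geom (suc m))

m+1+n≤1+o⇒m+n≤o : ∀ m {n o} → m +ℕ suc n ≤ℕ suc o → m +ℕ n ≤ℕ o
m+1+n≤1+o⇒m+n≤o m {n} {o} le = ℕP.≤-pred (subst (_≤ℕ suc o) (ℕP.+-suc m n) le)

mutual
  expand-bound : ∀ b k Q → b +ℕ length Q ≤ℕ suc k → Supported (b ≤ℕ_) (expand k Q)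
  expand-bound b k []       _ = []
  expand-bound b k (c ∷ cs) h =
    ℕP.m+n≤o⇒m≤o b (m+1+n≤1+o⇒m+n≤o b h) ∷ expandX-bound b k cs (m+1+n≤1+o⇒m+n≤o b h)

  expandX-bound : ∀ b k cs → b +ℕ length cs ≤ℕ k → Supported (b ≤ℕ_) (expandX k cs)
  expandX-bound b zero    cs h = []
  expandX-bound b (suc k) cs h =
    ++⁺ (expand-bound b (suc k) cs (ℕP.m≤n⇒m≤1+n h)) (map⁺ (expand-bound b k cs h))

evalAt-one : ∀ m → evalAt (1ℚ ∷ []) m ≈ onePS
evalAt-one m n = trans (cong₂ _+_ (ℚP.*-identityˡ (onePS n)) (·-zeroʳ (mono m) n)) (ℚP.+-identityʳ _)

evalAt-X : ∀ m → evalAt (0ℚ ∷ 1ℚ ∷ []) m ≈ mono m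
evalAt-X m n = trans (cong₂ _+_ (ℚP.*-zeroˡ (onePS n))
                                (trans (·-congˡ (mono m) (evalAt-one m) n) (·-identityʳ (mono m) n)))
                     (ℚP.+-identityˡ _)

factor-one-expand : ∀ m k Q → length Q ≤ℕ suc k →
  factor k Q (suc m) ≈ lincomb (λ j → factor j (1ℚ ∷ []) (suc m)) (expand k Q)
factor-one-expand m k Q |Q|≤1+k = begin
  factor k Q (suc m)                                  ≈⟨ factor-expand m k Q |Q|≤1+k ⟩
  lincomb (pow (geom (suc m))) (expand k Q)           ≈⟨ lincomb-cong (expand k Q) one·Gʲ ⟩
  lincomb (λ j → factor j (1ℚ ∷ []) (suc m)) (expand k Q) ∎
  where
  one·Gʲ : ∀ j → pow (geom (suc m)) j ≈ factor j (1ℚ ∷ []) (suc m)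
  one·Gʲ j = begin
    pow (geom (suc m)) j           ≈⟨ ≈-sym (·-identityˡ _) ⟩
    onePS · pow (geom (suc m)) j   ≈⟨ ·-congʳ (pow (geom (suc m)) j) (≈-sym (evalAt-one (suc m))) ⟩
    factor j (1ℚ ∷ []) (suc m)     ∎

expandHead : ℕ → Poly → Comb ℕ
expandHead k []       = []
expandHead k (_ ∷ cs) = expand k cs

factor-X-expandHead : ∀ m k Q → ConstZero Q → length Q ≤ℕ suc k →
  factor k Q (suc m) ≈ lincomb (λ j → factor j (0ℚ ∷ 1ℚ ∷ []) (suc m)) (expandHead k Q)
factor-X-expandHead m k []       _    _           = ·-zeroˡ (pow (geom (suc m)) k)
factor-X-expandHead m k (c ∷ cs) refl (s≤s |cs|≤k) = begin
  (scale 0ℚ onePS ⊕ (X · evalAt cs (suc m))) · Gᵏ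
    ≈⟨ ·-congʳ Gᵏ (λ n → trans (cong (_+ (X · evalAt cs (suc m)) n) (ℚP.*-zeroˡ (onePS n)))
                                (ℚP.+-identityˡ ((X · evalAt cs (suc m)) n))) ⟩
  (X · evalAt cs (suc m)) · Gᵏ
    ≈⟨ mono·-assoc (suc m) (evalAt cs (suc m)) Gᵏ ⟩
  X · factor k cs (suc m)
    ≈⟨ ·-congˡ X (factor-expand m k cs (ℕP.m≤n⇒m≤1+n |cs|≤k)) ⟩
  X · lincomb (pow (geom (suc m))) (expand k cs)
    ≈⟨ lincomb-·ˡ (pow (geom (suc m))) X (expand k cs) ⟩
  lincomb (λ j → X · pow (geom (suc m)) j) (expand k cs)
    ≈⟨ lincomb-cong (expand k cs) (λ j → ·-congʳ (pow (geom (suc m)) j) (≈-sym (evalAt-X (suc m)))) ⟩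
  lincomb (λ j → factor j (0ℚ ∷ 1ℚ ∷ []) (suc m)) (expand k cs) ∎
  where
  X : PS
  X = mono (suc m)
  Gᵏ : PS
  Gᵏ = pow (geom (suc m)) k

innerData : List ℕ → Data
innerData = map (λ j → (j , 1ℚ ∷ []))

expandInner : Data → Comb (List ℕ)
expandInner []             = (1ℚ , []) ∷ []
expandInner ((k , Q) ∷ ds) = expand k Q ∷ᶜ expandInner ds

expandAll : Data → Comb (List ℕ)
expandAll []             = (1ℚ , []) ∷ []
expandAll ((k , Q) ∷ ds) = expandHead k Q ∷ᶜ expandInner ds

S-expandInner : ∀ ds → All DegOK ds → ∀ M → S ds M ≈ lincomb (λ ks → S (innerData ks) M) (expandInner ds)
S-expandInner []             []             M = ≈-sym (lincomb-singleton (λ ks → S (innerData ks) M) [])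
S-expandInner ((k , Q) ∷ ds) (|Q|≤1+k ∷ degs) M = begin
  S ((k , Q) ∷ ds) M
    ≈⟨ S-cons-linear k Q ds (_, 1ℚ ∷ []) innerData (expand k Q) (expandInner ds)
         (λ m → factor-one-expand m k Q |Q|≤1+k) (S-expandInner ds degs) M ⟩
  lincomb (λ p → S (innerData (proj₁ p ∷ proj₂ p)) M) (expand k Q ⊗ expandInner ds)
    ≈⟨ ≈-sym (lincomb-mapC (λ ks → S (innerData ks) M) (uncurry _∷_) (expand k Q ⊗ expandInner ds)) ⟩
  lincomb (λ ks → S (innerData ks) M) (expand k Q ∷ᶜ expandInner ds) ∎

ζq-expandAll : ∀ ds → ZqAdm ds → ζq ds ≈ lincomb ζOOZ (expandAll ds)
ζq-expandAll []             _                         = ≈-sym (lincomb-singleton ζOOZ [])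
ζq-expandAll ((k , Q) ∷ ds) (cz , |Q|≤1+k , degs) n =
  trans (S-cons-linear k Q ds (_, 0ℚ ∷ 1ℚ ∷ []) innerData E L
           (λ m → factor-X-expandHead m k Q cz |Q|≤1+k) (S-expandInner ds degs) (suc n) n)
  (trans (lincomb-diagonal (λ p → S ((proj₁ p , 0ℚ ∷ 1ℚ ∷ []) ∷ innerData (proj₂ p))) (E ⊗ L) n)
         (sym (lincomb-mapC ζOOZ (uncurry _∷_) (E ⊗ L) n)))
  where
  E : Comb ℕ
  E = expandHead k Q
  L : Comb (List ℕ)
  L = expandInner ds

expandHead-bound : ∀ b k Q → b +ℕ length Q ≤ℕ 2 +ℕ k → Supported (b ≤ℕ_) (expandHead k Q)
expandHead-bound b k []       _ = []
expandHead-bound b k (_ ∷ cs) h = expand-bound b k cs (m+1+n≤1+o⇒m+n≤o b h)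

expandInner-supported : ∀ {D : ℕ × Poly → Set} {R : ℕ → Set} →
  (∀ {k Q} → D (k , Q) → Supported R (expand k Q)) → ∀ ds → All D ds → Supported (All R) (expandInner ds)
expandInner-supported bound []             []       = [] ∷ []
expandInner-supported bound ((k , Q) ∷ ds) (d ∷ dd) =
  ∷ᶜ-supported (bound d) (expandInner-supported bound ds dd) _∷_

expandAll-supported : ∀ ds → ZqAdm ds → Supported OOZAdm (expandAll ds)
expandAll-supported []             _                  = tt ∷ []
expandAll-supported ((k , Q) ∷ ds) (_ , |Q|≤1+k , _) =
  ∷ᶜ-supported (expandHead-bound 1 k Q (s≤s |Q|≤1+k)) (All.universal (λ _ → tt) _) (λ 1≤j _ → 1≤j)

expandAll-supported₁ : ∀ ds → Zq1Adm ds → Supported OOZ1Adm (expandAll ds)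
expandAll-supported₁ []             _                        = tt ∷ []
expandAll-supported₁ ((k , Q) ∷ ds) (_ , (_ , |Q|≤k) , degs) =
  ∷ᶜ-supported (expandHead-bound 2 k Q (s≤s (s≤s |Q|≤k)))
               (expandInner-supported (λ deg → expand-bound 1 _ _ (s≤s (proj₂ deg))) ds degs) _,_

Zq1Adm⇒ZqAdm : ∀ ds → Zq1Adm ds → ZqAdm ds
Zq1Adm⇒ZqAdm []             _                        = tt
Zq1Adm⇒ZqAdm ((k , Q) ∷ ds) (cz , (_ , |Q|≤k) , degs) =
  cz , ℕP.m≤n⇒m≤1+n |Q|≤k , All.map (ℕP.m≤n⇒m≤1+n ∘ proj₂) degs

ζq∈OOZSpan : (d : Σ Data ZqAdm) → OOZSpan (ζq (proj₁ d))
ζq∈OOZSpan (ds , adm) =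
  supported-span ζOOZ (expandAll ds) (expandAll-supported ds adm) (ζq-expandAll ds adm)

ζq∈OOZSpan₁ : (d : Σ Data Zq1Adm) → OOZSpan1 (ζq (proj₁ d))
ζq∈OOZSpan₁ (ds , adm) =
  supported-span ζOOZ (expandAll ds) (expandAll-supported₁ ds adm) (ζq-expandAll ds (Zq1Adm⇒ZqAdm ds adm))

ζOOZ∈𝒵q : (i : Σ (List ℕ) OOZAdm) → 𝒵q (ζOOZ (proj₁ i))
ζOOZ∈𝒵q ([]     , _)   = span-generator _ ([] , tt)
ζOOZ∈𝒵q (k ∷ ks , 1≤k) = span-generator _
  ((k , 0ℚ ∷ 1ℚ ∷ []) ∷ innerData ks , refl , s≤s 1≤k , map⁺ (All.universal (λ _ → s≤s z≤n) ks))

ζOOZ∈𝒵q₁ : (i : Σ (List ℕ) OOZ1Adm) → 𝒵q1 (ζOOZ (proj₁ i))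
ζOOZ∈𝒵q₁ ([]     , _)          = span-generator _ ([] , tt)
ζOOZ∈𝒵q₁ (k ∷ ks , 2≤k , 1≤ks) = span-generator _
  ((k , 0ℚ ∷ 1ℚ ∷ []) ∷ innerData ks , refl , (ℕP.<⇒≤ 2≤k , 2≤k) , map⁺ (All.map (λ 1≤j → 1≤j , 1≤j) 1≤ks))

proposition2p59 : ((f : PS) → 𝒵q1 f ⇔ OOZSpan1 f) × ((f : PS) → 𝒵q f ⇔ OOZSpan f)
proposition2p59 =
  (λ f → mk⇔ (span-trans ζq∈OOZSpan₁ f) (span-trans ζOOZ∈𝒵q₁ f)) ,
  (λ f → mk⇔ (span-trans ζq∈OOZSpan f) (span-trans ζOOZ∈𝒵q f))
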